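{- Let $f\colon\mathbb{N}^2\to\mathbb{N}$ be any pairing function with cubic shells, and let $\phi_f$ be the function on $\mathbb{N}$ defined by $\phi_f(0)=o$ and $\phi_f(f(x,y)+1)=\tau(\phi_f(x),\phi_f(y))$ for all $(x,y)\in\mathbb{N}^2$. Then the sequence $H(\phi_f(0)),\ H(\phi_f(1)),\ H(\phi_f(2)),\ \ldots$ is non-decreasing.
   Context: $\mathbb{N}$ denotes the set of non-negative integers. A pairing function for $\mathbb{N}$ is a bijection $f\colon\mathbb{N}^2\to\mathbb{N}$; it has cubic shells if for all $\mathbf{x},\mathbf{y}\in\mathbb{N}^2$, $\max(\mathbf{x})<\max(\mathbf{y})$ implies $f(\mathbf{x})<f(\mathbf{y})$. Such an $f$ satisfies $\max(x,y)\le f(x,y)$, so the recursion defining $\phi_f$ determines a unique function on $\mathbb{N}$. $o$ denotes the one-vertex binary tree and $\tau(a,b)$ denotes the binary tree with left subtree $a$ and right subtree $b$. The height $H(t)$ of a binary tree $t$ is the length of the longest path from a leaf to the root; thus $H(o)=0$ and $H(\tau(a,b))=1+\max(H(a),H(b))$. -}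

module Defs where

open import Data.Nat using (ℕ; zero; suc; _<_; _≤_; _⊔_)
open import Data.Product using (_×_; _,_; ∃; ∃-syntax)
open import Relation.Binary.PropositionalEquality using (_≡_)

-- binary trees: o is the one-vertex tree, τ a b has left subtree a, right subtree b
data Tree : Set where
  o : Tree
  τ : Tree → Tree → Tree

H : Tree → ℕ
H o = 0
H (τ a b) = suc (H a ⊔ H b)

IsPairing : (ℕ → ℕ → ℕ) → Set
IsPairing f =
  (∀ x y x' y' → f x y ≡ f x' y' → (x ≡ x' × y ≡ y'))
  × (∀ n → ∃[ x ] ∃[ y ] f x y ≡ n)

CubicShells : (ℕ → ℕ → ℕ) → Set
CubicShells f = ∀ x y x' y' → (x ⊔ y) < (x' ⊔ y') → f x y < f x' y'

-- φ satisfies the defining recursion of φ_f (which determines φ uniquely)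
IsPhi : (ℕ → ℕ → ℕ) → (ℕ → Tree) → Set
IsPhi f φ = (φ 0 ≡ o) × (∀ x y → φ (suc (f x y)) ≡ τ (φ x) (φ y))

module Submission where

-- Write h n = H (φ n).  We show h n ≤ h (n + 1) by strong
-- induction on n, assuming the steps below n, i.e. that h is monotone on
-- [0, n].  For n = 0 this is H o = 0.  For n = k + 1, surjectivity of f gives
-- k = f x y and k + 1 = f x' y', so h (k+1) = 1 + max (h x) (h y) and
-- h (k+2) = 1 + max (h x') (h y').  Two facts about pairings with cubic
-- shells control the arguments: max x y ≤ f x y (the shell of f x y contains
-- its diagonal predecessors), and f x y < f x' y' forces max x y ≤ max x' y'.
-- Hence all of x, y, x', y', max x y, max x' y' lie in [0, k + 1], and
--   max (h x) (h y) ≤ h (max x y) ≤ h (max x' y') ≤ max (h x') (h y').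

open import Defs
open import Data.Nat using (ℕ; zero; suc; _≤_; _<_; _⊔_; z≤n; s≤s)
open import Data.Nat.Properties
open import Data.Nat.Induction using (<-rec)
open import Data.Product using (_,_; proj₁; proj₂; ∃-syntax)
open import Data.Sum using (inj₁; inj₂)
open import Function using (_∘_)
open import Relation.Binary.PropositionalEquality
open import Relation.Nullary using (yes; no)
open import Data.Empty using (⊥-elim)

module Shells (f : ℕ → ℕ → ℕ) (cs : CubicShells f) where

  -- A pair whose maximum is m is sent to a number ≥ m: by induction on m,
  -- since (m-1, m-1) lies in an earlier shell and f (m-1) (m-1) ≥ m-1.
  max≤pair : ∀ m x y → x ⊔ y ≡ m → m ≤ f x y
  max≤pair zero    x y _  = z≤n
  max≤pair (suc k) x y eq = begin-strict
    k         ≤⟨ max≤pair k k k (⊔-idem k) ⟩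
    f k k     <⟨ cs k k x y k⊔k<x⊔y ⟩
    f x y     ∎
    where
    open ≤-Reasoning
    k⊔k<x⊔y : k ⊔ k < x ⊔ y
    k⊔k<x⊔y = subst₂ _<_ (sym (⊔-idem k)) (sym eq) ≤-refl

  ⊔≤pair : ∀ x y → x ⊔ y ≤ f x y
  ⊔≤pair x y = max≤pair (x ⊔ y) x y refl

  -- Contrapositive of cubic shells: the order of codes bounds the shells.
  shell-monotone : ∀ x y x' y' → f x y < f x' y' → x ⊔ y ≤ x' ⊔ y'
  shell-monotone x y x' y' lt with x ⊔ y ≤? x' ⊔ y'
  ... | yes le = le
  ... | no  gt = ⊥-elim (<-asym lt (cs x' y' x y (≰⇒> gt)))

MonotoneUpTo : (ℕ → ℕ) → ℕ → Set
MonotoneUpTo g n = ∀ {a b} → a ≤ b → b ≤ n → g a ≤ g b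

steps⇒monotoneUpTo : ∀ (g : ℕ → ℕ) n →
  (∀ {m} → m < n → g m ≤ g (suc m)) → MonotoneUpTo g n
steps⇒monotoneUpTo g n steps {a} {zero}  a≤0 _ with a≤0
... | z≤n = ≤-refl
steps⇒monotoneUpTo g n steps {a} {suc b} a≤b+1 b+1≤n with m≤n⇒m<n∨m≡n a≤b+1
... | inj₂ refl      = ≤-refl
... | inj₁ (s≤s a≤b) =
  ≤-trans (steps⇒monotoneUpTo g n steps a≤b (≤-trans (n≤1+n b) b+1≤n))
          (steps b+1≤n)

⊔-below : ∀ (g : ℕ → ℕ) n → MonotoneUpTo g n →
  ∀ x y → x ⊔ y ≤ n → g x ⊔ g y ≤ g (x ⊔ y)
⊔-below g n mono x y x⊔y≤n =
  ⊔-lub (mono (m≤m⊔n x y) x⊔y≤n) (mono (m≤n⊔m x y) x⊔y≤n)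

⊔-above : ∀ (g : ℕ → ℕ) x y → g (x ⊔ y) ≤ g x ⊔ g y
⊔-above g x y with ⊔-sel x y
... | inj₁ x⊔y≡x rewrite x⊔y≡x = m≤m⊔n (g x) (g y)
... | inj₂ x⊔y≡y rewrite x⊔y≡y = m≤n⊔m (g x) (g y)

module Heights (f : ℕ → ℕ → ℕ) (cs : CubicShells f)
               (surj : ∀ n → ∃[ x ] ∃[ y ] f x y ≡ n)
               (φ : ℕ → Tree) (isPhi : IsPhi f φ) where

  open Shells f cs

  h : ℕ → ℕ
  h n = H (φ n)

  h-code : ∀ x y → h (suc (f x y)) ≡ suc (h x ⊔ h y)
  h-code x y = cong H (proj₂ isPhi x y)

  step : ∀ n → (∀ {m} → m < n → h m ≤ h (suc m)) → h n ≤ h (suc n)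
  step zero _ = subst (λ t → H t ≤ h 1) (sym (proj₁ isPhi)) z≤n
  step (suc k) steps with surj k | surj (suc k)
  ... | x , y , refl | x' , y' , code' = begin
    h (suc (f x y))        ≡⟨ h-code x y ⟩
    suc (h x ⊔ h y)        ≤⟨ s≤s heights ⟩
    suc (h x' ⊔ h y')      ≡⟨ sym (h-code x' y') ⟩
    h (suc (f x' y'))      ≡⟨ cong (h ∘ suc) code' ⟩
    h (suc (suc (f x y)))  ∎
    where
    open ≤-Reasoning
    n = suc (f x y)

    mono : MonotoneUpTo h n
    mono = steps⇒monotoneUpTo h n steps

    x⊔y≤n : x ⊔ y ≤ n
    x⊔y≤n = ≤-trans (⊔≤pair x y) (n≤1+n (f x y))

    x'⊔y'≤n : x' ⊔ y' ≤ n
    x'⊔y'≤n = subst (x' ⊔ y' ≤_) code' (⊔≤pair x' y')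

    shells : x ⊔ y ≤ x' ⊔ y'
    shells = shell-monotone x y x' y' (subst (f x y <_) (sym code') ≤-refl)

    heights : h x ⊔ h y ≤ h x' ⊔ h y'
    heights = begin
      h x ⊔ h y        ≤⟨ ⊔-below h n mono x y x⊔y≤n ⟩
      h (x ⊔ y)        ≤⟨ mono shells x'⊔y'≤n ⟩
      h (x' ⊔ y')      ≤⟨ ⊔-above h x' y' ⟩
      h x' ⊔ h y'      ∎

theorem9 : (f : ℕ → ℕ → ℕ) → IsPairing f → CubicShells f →
    (φ : ℕ → Tree) → IsPhi f φ →
    ∀ n → H (φ n) ≤ H (φ (suc n))
theorem9 f (_ , surj) cs φ isPhi =
  <-rec (λ n → h n ≤ h (suc n)) step
  where open Heights f cs surj φ isPhi
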